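{- Let $H$ be a connected finite hypergraph without loops in which every hypervertex belongs to at least two hyperedges, $B_H$ its bipartite graph with $m=|E(B_H)|$, $E(R(B_H))=\{e_1,\dots,e_{2m}\}$, $\phi$ a permutation voltage assignment on $B_H$, $\Gamma=\langle\phi(e)\mid e\in E(R(B_H))\rangle$, and $\rho$ a representation of $\Gamma$ of degree $l$. Let $M_1,\dots,M_{2m}$ be the $2ml\times 2ml$ matrices such that, for each $i$, the rows of $M_i$ indexed by $l(i-1)+1,\dots,li$ coincide with the corresponding rows of $B+uJ$, and all other rows of $M_i$ are zero. Let $C=(e_{s_1},\dots,e_{s_k})$ be a sequence of directed edges of $R(B_H)$ (so $|C|=k$). Then $$\det\big(I_{2ml}-M_{s_1}\cdots M_{s_k}t^{|C|}\big)=\begin{cases}\det\big(I_l-\rho(\phi(C))u^{\mathrm{cbc}(C)}t^{|C|}\big)&\text{if } C\text{ is a cycle},\\ 1&\text{otherwise.}\end{cases}$$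
   Context: A hypergraph $H$ is a finite set $V(H)$ with a finite collection $E(H)$ of nonempty subsets (hyperedges) covering $V(H)$; "without loops" means no hyperedge has one element. $B_H$ has vertex set $V(H)\sqcup E(H)$ and edges $\{v,e\}$ for $v\in e$. $R(B_H)$ is the symmetric digraph with directed edges $(x,y),(y,x)$ for each edge $\{x,y\}$; for $e=(x,y)$: $o(e)=x$, $t(e)=y$, $e^{ -1}=(y,x)$. A permutation voltage assignment is $\phi:E(R(B_H))\to\mathcal{S}_k$ with $\phi(e^{ -1})=\phi(e)^{ -1}$. A sequence $C=(f_1,\dots,f_r)$ of directed edges is a cycle if $t(f_i)=o(f_{i+1})$ for $i<r$ and $t(f_r)=o(f_1)$; then $\mathrm{cbc}(C)=|\{i\in\{1,\dots,r\}: f_{i+1}=f_i^{ -1}\}|$ with $f_{r+1}=f_1$, and $\rho(\phi(C))=\rho(\phi(f_1))\cdots\rho(\phi(f_r))$. $B=(b_{\alpha\beta})$, $J=(j_{\alpha\beta})$ are $2m\times2m$ block matrices with $l\times l$ blocks: $b_{\alpha\beta}=\rho(\phi(e_\alpha))$ if $t(e_\alpha)=o(e_\beta)$ and $e_\alpha\ne e_\beta^{ -1}$, else $0_l$; $j_{\alpha\beta}=\rho(\phi(e_\alpha))$ if $e_\alpha=e_\beta^{ -1}$, else $0_l$. -}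

module Defs where

open import Level using (Level)
open import Data.Nat as ℕ using (ℕ; zero; suc; _<?_)
open import Data.Bool using (Bool; true; false; not; if_then_else_)
open import Data.Fin as Fin using (Fin; zero; suc; toℕ; fromℕ<; punchIn; quotRem; _≟_)
open import Data.Fin.Permutation as P using (Permutation′; _∘ₚ_; flip; _⟨$⟩ʳ_)
open import Data.Sum using (_⊎_; inj₁; inj₂)
open import Data.Sum.Properties using (≡-dec)
open import Data.Product using (_×_; _,_; ∃; ∃-syntax; proj₁; proj₂)
open import Relation.Nullary using (¬_; Dec; yes; no)
open import Relation.Binary.PropositionalEquality using (_≡_; _≢_)
open import Function.Bundles using (_↔_; Inverse)
open import Algebra.Bundles using (CommutativeRing)

record Hypergraph : Set where
  field
    nV  : ℕ
    nE  : ℕ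
    inc : Fin nV → Fin nE → Bool
open Hypergraph public

NonemptyEdges : Hypergraph → Set
NonemptyEdges H = ∀ (e : Fin (nE H)) → ∃[ v ] inc H v e ≡ true

Covering : Hypergraph → Set
Covering H = ∀ (v : Fin (nV H)) → ∃[ e ] inc H v e ≡ true

-- without loops: no hyperedge has exactly one element
-- (together with NonemptyEdges: every hyperedge has >= 2 elements)
WithoutLoops : Hypergraph → Set
WithoutLoops H = ∀ (e : Fin (nE H)) (v : Fin (nV H)) → inc H v e ≡ true →
  ∃[ w ] (w ≢ v × inc H w e ≡ true)

DegreeAtLeastTwo : Hypergraph → Set
DegreeAtLeastTwo H = ∀ (v : Fin (nV H)) →
  ∃[ e ] ∃[ e′ ] (e ≢ e′ × inc H v e ≡ true × inc H v e′ ≡ true)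

BVert : Hypergraph → Set
BVert H = Fin (nV H) ⊎ Fin (nE H)

-- a directed edge of R(B_H): an edge {v,e} of B_H (v ∈ e) with a direction;
-- fromV = true means the arc (v,e), fromV = false means the arc (e,v).
record Arc (H : Hypergraph) : Set where
  constructor arc
  field
    av    : Fin (nV H)
    ae    : Fin (nE H)
    ainc  : inc H av ae ≡ true
    fromV : Bool
open Arc public

o : ∀ {H} → Arc H → BVert H
o a = if fromV a then inj₁ (av a) else inj₂ (ae a)

t : ∀ {H} → Arc H → BVert H
t a = if fromV a then inj₂ (ae a) else inj₁ (av a)

_⁻¹ : ∀ {H} → Arc H → Arc H
arc v e p b ⁻¹ = arc v e p (not b)

-- connectedness of H := connectedness of B_H
data Reach {H : Hypergraph} : BVert H → BVert H → Set where
  here : ∀ {x} → Reach x x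
  step : ∀ {y} (a : Arc H) → Reach {H} (t a) y → Reach {H} (o a) y

Connected : Hypergraph → Set
Connected H = ∀ (x y : BVert H) → Reach {H} x y

_≟V_ : ∀ {H} → (x y : BVert H) → Dec (x ≡ y)
_≟V_ = ≡-dec _≟_ _≟_

record PermVoltage (H : Hypergraph) (n : ℕ) : Set where
  field
    φ     : Arc H → Permutation′ n
    φ-inv : ∀ a → φ (a ⁻¹) P.≈ flip (φ a)
open PermVoltage public

data InΓ {H : Hypergraph} {n : ℕ} (Φ : PermVoltage H n) : Permutation′ n → Set where
  gen  : ∀ a → InΓ Φ (φ Φ a)
  one  : InΓ Φ P.id
  mul  : ∀ {σ τ} → InΓ Φ σ → InΓ Φ τ → InΓ Φ (σ ∘ₚ τ)
  inv  : ∀ {σ} → InΓ Φ σ → InΓ Φ (flip σ)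
  resp : ∀ {σ τ} → σ P.≈ τ → InΓ Φ σ → InΓ Φ τ

module _ {c ℓ : Level} (R : CommutativeRing c ℓ) where
  open CommutativeRing R using (Carrier; _≈_; _+_; _*_; -_; _-_; 0#; 1#)

  Mat : ℕ → ℕ → Set c
  Mat a b = Fin a → Fin b → Carrier

  Σ : ∀ {n} → (Fin n → Carrier) → Carrier
  Σ {zero}  f = 0#
  Σ {suc n} f = f zero + Σ (λ i → f (suc i))

  _≋_ : ∀ {a b} → Mat a b → Mat a b → Set ℓ
  A ≋ B = ∀ i j → A i j ≈ B i j

  I : ∀ {n} → Mat n n
  I i j with i ≟ j
  ... | yes _ = 1#
  ... | no  _ = 0#

  O : ∀ {a b} → Mat a b
  O _ _ = 0#

  _·_ : ∀ {a b d} → Mat a b → Mat b d → Mat a d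
  (A · B) i j = Σ (λ k → A i k * B k j)

  _⊕_ : ∀ {a b} → Mat a b → Mat a b → Mat a b
  (A ⊕ B) i j = A i j + B i j

  _⊖_ : ∀ {a b} → Mat a b → Mat a b → Mat a b
  (A ⊖ B) i j = A i j - B i j

  _⊛_ : ∀ {a b} → Carrier → Mat a b → Mat a b
  (x ⊛ A) i j = x * A i j

  Π : ∀ {n k} → (Fin k → Mat n n) → Mat n n
  Π {k = zero}  A = I
  Π {k = suc k} A = A zero · Π (λ i → A (suc i))

  pow : Carrier → ℕ → Carrier
  pow x zero    = 1#
  pow x (suc k) = x * pow x k

  sgn : ℕ → Carrier
  sgn zero    = 1#
  sgn (suc k) = - sgn k

  det : ∀ {n} → Mat n n → Carrier
  det {zero}  A = 1#
  det {suc n} A = Σ (λ j → sgn (toℕ j) * (A zero j * det (λ r c′ → A (suc r) (punchIn j c′))))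

  record IsRepresentation {H : Hypergraph} {n l : ℕ} (Φ : PermVoltage H n)
                          (ρ : Permutation′ n → Mat l l) : Set (c Level.⊔ ℓ) where
    field
      ρ-cong : ∀ {σ τ} → InΓ Φ σ → σ P.≈ τ → ρ σ ≋ ρ τ
      ρ-id   : ρ P.id ≋ I
      ρ-hom  : ∀ {σ τ} → InΓ Φ σ → InΓ Φ τ → ρ (σ ∘ₚ τ) ≋ (ρ σ · ρ τ)

  module Setup {H : Hypergraph} {m n l : ℕ} (en : Fin (2 ℕ.* m) ↔ Arc H)
               (Φ : PermVoltage H n) (ρ : Permutation′ n → Mat l l) (u : Carrier) where

    e : Fin (2 ℕ.* m) → Arc H
    e = Inverse.to en

    invIdx : Fin (2 ℕ.* m) → Fin (2 ℕ.* m)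
    invIdx β = Inverse.from en (e β ⁻¹)

    ρφ : Fin (2 ℕ.* m) → Mat l l
    ρφ α = ρ (φ Φ (e α))

    bBlock : Fin (2 ℕ.* m) → Fin (2 ℕ.* m) → Mat l l
    bBlock α β with _≟V_ {H} (t (e α)) (o (e β)) | α ≟ invIdx β
    ... | yes _ | no _ = ρφ α
    ... | _     | _    = O

    jBlock : Fin (2 ℕ.* m) → Fin (2 ℕ.* m) → Mat l l
    jBlock α β with α ≟ invIdx β
    ... | yes _ = ρφ α
    ... | no  _ = O

    -- assemble a 2m × 2m block matrix of l × l blocks into a 2ml × 2ml matrix
    -- (row l(α-1)+i ↦ block α, entry i)
    flatten : (Fin (2 ℕ.* m) → Fin (2 ℕ.* m) → Mat l l) → Mat (2 ℕ.* m ℕ.* l) (2 ℕ.* m ℕ.* l)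
    flatten F r c′ with quotRem l r | quotRem l c′
    ... | (i , α) | (j , β) = F α β i j

    Bm Jm : Mat (2 ℕ.* m ℕ.* l) (2 ℕ.* m ℕ.* l)
    Bm = flatten bBlock
    Jm = flatten jBlock

    M : Fin (2 ℕ.* m) → Mat (2 ℕ.* m ℕ.* l) (2 ℕ.* m ℕ.* l)
    M α r c′ with proj₂ (quotRem l r) ≟ α
    ... | yes _ = (Bm ⊕ (u ⊛ Jm)) r c′
    ... | no  _ = 0#

  -- sequences C = (e_{s_0}, …, e_{s_k}) of length k+1 ≥ 1

  next : ∀ {k} → Fin (suc k) → Fin (suc k)
  next {k} i with suc (toℕ i) <? suc k
  ... | yes p = fromℕ< p
  ... | no  _ = zero

  count : ∀ {k} → (P : Fin k → Set) → (∀ i → Dec (P i)) → ℕ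
  count {zero}  P d = 0
  count {suc k} P d with d zero
  ... | yes _ = suc (count (λ i → P (suc i)) (λ i → d (suc i)))
  ... | no  _ = count (λ i → P (suc i)) (λ i → d (suc i))

  module Seq {H : Hypergraph} {m : ℕ} (en : Fin (2 ℕ.* m) ↔ Arc H)
             {k : ℕ} (s : Fin (suc k) → Fin (2 ℕ.* m)) where

    f : Fin (suc k) → Arc H
    f i = Inverse.to en (s i)

    IsCycle : Set
    IsCycle = ∀ i → t (f i) ≡ o (f (next i))

    cbc : ℕ
    cbc = count (λ i → f (next i) ≡ f i ⁻¹)
                (λ i → s (next i) ≟ Inverse.from en (f i ⁻¹) |> conv i)
      where
        open import Function using (_|>_)
        open import Relation.Nullary using (map′)
        open import Relation.Binary.PropositionalEquality using (cong; sym; trans)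
        conv : ∀ i → Dec (s (next i) ≡ Inverse.from en (f i ⁻¹)) → Dec (f (next i) ≡ f i ⁻¹)
        conv i = map′ (λ q → trans (cong (Inverse.to en) q) (Inverse.strictlyInverseˡ en (f i ⁻¹)))
                      (λ q → trans (sym (Inverse.strictlyInverseʳ en (s (next i))))
                                   (cong (Inverse.from en) q))

-- Every row of M_α outside block α is zero, so the rows of M_{s_1} ⋯ M_{s_k} outside block s_1
-- vanish, I − t^k M_{s_1} ⋯ M_{s_k} has unit rows there, and its determinant is that of its
-- diagonal (s_1, s_1) block.  Multiplying out, that block is I − t^k times the product of the
-- blocks (B + uJ)_{s_i s_{i+1}} around the closed sequence (indices mod k).  Such a block is
-- u ρ(φ(e_{s_i})) at a backtrack, ρ(φ(e_{s_i})) at any other consecutive pair of arcs, and 0 when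
-- t(e_{s_i}) ≠ o(e_{s_{i+1}}): a cycle yields u^cbc(C) ρ(φ(C)), anything else a zero block and
-- determinant 1.

module Submission where

open import Defs
open import Level using (Level)
open import Data.Nat using (ℕ; suc; _*_)
open import Data.Fin using (Fin)
open import Data.Fin.Permutation using (Permutation′)
open import Data.Product using (_×_)
open import Relation.Nullary using (¬_)
open import Function.Bundles using (_↔_)
open import Algebra.Bundles using (CommutativeRing)

open import Data.Nat as ℕ using (zero; _<?_)
import Data.Nat.Properties as ℕ
open import Data.Bool using (true; false; if_then_else_)
open import Data.Fin
  using (zero; suc; toℕ; punchIn; inject₁; fromℕ; combine; remQuot; quotRem; _↑ˡ_; _↑ʳ_; _≟_)
open import Data.Fin.Properties
  using (toℕ-injective; toℕ-↑ˡ; toℕ-fromℕ; toℕ-fromℕ<; toℕ-inject₁; inject₁ℕ<; suc-injective; ↑ʳ-injective;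
         punchInᵢ≢i; punchIn-injective; combine-remQuot; remQuot-combine; combine-injectiveʳ; ¬∀⟶∃¬)
open import Data.Product using (_,_; proj₁; proj₂; swap)
open import Relation.Nullary using (Dec; yes; no; ⌊_⌋; map′; contradiction)
open import Relation.Binary.PropositionalEquality as ≡ using (_≡_; _≢_)
open import Function.Base using (_∘_)
open import Function.Bundles using (Inverse; Injection)
open import Function.Properties.Inverse using (↔⇒↣)
import Algebra.Properties.CommutativeMonoid.Sum as CommutativeMonoidSum
import Algebra.Properties.Monoid.Sum as MonoidSum
import Algebra.Properties.Semiring.Sum as SemiringSum
import Algebra.Properties.Ring as RingProperties
import Algebra.Properties.CommutativeSemigroup as CommutativeSemigroupProperties
import Relation.Binary.Reasoning.Setoid as SetoidReasoning

punchIn-↑ˡ : ∀ {a} b (j : Fin (suc a)) (i : Fin a) → punchIn (j ↑ˡ b) (i ↑ˡ b) ≡ punchIn j i ↑ˡ b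
punchIn-↑ˡ b zero    i       = ≡.refl
punchIn-↑ˡ b (suc j) zero    = ≡.refl
punchIn-↑ˡ b (suc j) (suc i) = ≡.cong suc (punchIn-↑ˡ b j i)

punchIn-↑ˡ-↑ʳ : ∀ a b (j : Fin (suc a)) (q : Fin b) → punchIn (j ↑ˡ b) (a ↑ʳ q) ≡ suc a ↑ʳ q
punchIn-↑ˡ-↑ʳ zero    b zero    q = ≡.refl
punchIn-↑ˡ-↑ʳ (suc a) b zero    q = ≡.refl
punchIn-↑ˡ-↑ʳ (suc a) b (suc j) q = ≡.cong suc (punchIn-↑ˡ-↑ʳ a b j q)

quotRem-combine : ∀ {nb} l (α : Fin nb) (i : Fin l) → quotRem l (combine α i) ≡ (i , α)
quotRem-combine l α i = ≡.cong swap (remQuot-combine α i)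

⁻¹-involutive : ∀ {H} (a : Arc H) → (a ⁻¹) ⁻¹ ≡ a
⁻¹-involutive (arc v e p true)  = ≡.refl
⁻¹-involutive (arc v e p false) = ≡.refl

⁻¹-swap : ∀ {H} {a b : Arc H} → a ≡ b ⁻¹ → b ≡ a ⁻¹
⁻¹-swap {b = b} ≡.refl = ≡.sym (⁻¹-involutive b)

t-⁻¹ : ∀ {H} (a : Arc H) → t (a ⁻¹) ≡ o a
t-⁻¹ (arc v e p true)  = ≡.refl
t-⁻¹ (arc v e p false) = ≡.refl

module MatrixProperties {c ℓ : Level} (R : CommutativeRing c ℓ) where
  open CommutativeRing R renaming (_*_ to _✶_) hiding (zero)
  open CommutativeMonoidSum +-commutativeMonoid using (sum; sum-cong-≋; sum-replicate-zero; sum-remove)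
  open SemiringSum semiring using (*-distribˡ-sum)
  open MonoidSum *-monoid public using () renaming (sum to product)
  open RingProperties ring using (-0#≈0#)
  open CommutativeSemigroupProperties *-commutativeSemigroup using (interchange)
  open SetoidReasoning setoid

  x-y≈x : ∀ {x y} → y ≈ 0# → x - y ≈ x
  x-y≈x {x} y≈0 = trans (+-congˡ (trans (-‿cong y≈0) -0#≈0#)) (+-identityʳ x)

  Σ≡sum : ∀ {n} (f : Fin n → Carrier) → Σ R f ≡ sum f
  Σ≡sum {zero}  f = ≡.refl
  Σ≡sum {suc n} f = ≡.cong (f zero +_) (Σ≡sum (f ∘ suc))

  Σ-cong : ∀ {n} {f g : Fin n → Carrier} → (∀ i → f i ≈ g i) → Σ R f ≈ Σ R g
  Σ-cong {f = f} {g} f≈g rewrite Σ≡sum f | Σ≡sum g = sum-cong-≋ f≈g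

  Σ-zero : ∀ {n} {f : Fin n → Carrier} → (∀ i → f i ≈ 0#) → Σ R f ≈ 0#
  Σ-zero {n} {f} f≈0 rewrite Σ≡sum f = trans (sum-cong-≋ f≈0) (sum-replicate-zero n)

  Σ-single : ∀ {n} {f : Fin n → Carrier} (i : Fin n) → (∀ j → j ≢ i → f j ≈ 0#) → Σ R f ≈ f i
  Σ-single {suc n} {f} i f≈0 rewrite Σ≡sum f = begin
    sum f                          ≈⟨ sum-remove f ⟩
    f i + sum (f ∘ punchIn i)
      ≈⟨ +-congˡ (trans (sum-cong-≋ (λ j → f≈0 _ (punchInᵢ≢i i j))) (sum-replicate-zero n)) ⟩
    f i + 0#                       ≈⟨ +-identityʳ (f i) ⟩
    f i                            ∎

  Σ-distribˡ : ∀ {n} x (f : Fin n → Carrier) → x ✶ Σ R f ≈ Σ R (λ i → x ✶ f i)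
  Σ-distribˡ x f rewrite Σ≡sum f | Σ≡sum (λ i → x ✶ f i) = *-distribˡ-sum x f

  Σ-splitAt : ∀ a b (f : Fin (a ℕ.+ b) → Carrier) →
              Σ R f ≈ Σ R (λ i → f (i ↑ˡ b)) + Σ R (λ j → f (a ↑ʳ j))
  Σ-splitAt zero    b f = sym (+-identityˡ _)
  Σ-splitAt (suc a) b f = trans (+-congˡ (Σ-splitAt a b (f ∘ suc))) (sym (+-assoc _ _ _))

  Σ-combine : ∀ nb l (f : Fin (nb * l) → Carrier) →
              Σ R f ≈ Σ R (λ β → Σ R (λ j → f (combine {nb} {l} β j)))
  Σ-combine zero     l f = refl
  Σ-combine (suc nb) l f = trans (Σ-splitAt l (nb * l) f) (+-congˡ (Σ-combine nb l (λ r → f (l ↑ʳ r))))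

  I-diag : ∀ {n} (i : Fin n) → I R i i ≈ 1#
  I-diag i with i ≟ i
  ... | yes _   = refl
  ... | no  i≢i = contradiction ≡.refl i≢i

  I-offDiag : ∀ {n} {i j : Fin n} → i ≢ j → I R i j ≈ 0#
  I-offDiag {i = i} {j} i≢j with i ≟ j
  ... | yes i≡j = contradiction i≡j i≢j
  ... | no  _   = refl

  ·-cong : ∀ {a b d} {A A′ : Mat R a b} {B B′ : Mat R b d} →
           _≋_ R A A′ → _≋_ R B B′ → _≋_ R (_·_ R A B) (_·_ R A′ B′)
  ·-cong A≋A′ B≋B′ i j = Σ-cong (λ k → *-cong (A≋A′ i k) (B≋B′ k j))

  ·-congˡ : ∀ {a b d} (A : Mat R a b) {B B′ : Mat R b d} →
            _≋_ R B B′ → _≋_ R (_·_ R A B) (_·_ R A B′)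
  ·-congˡ A = ·-cong (λ _ _ → refl)

  ·-identityʳ : ∀ {a b} (A : Mat R a b) → _≋_ R (_·_ R A (I R)) A
  ·-identityʳ A i j = begin
    Σ R (λ k → A i k ✶ I R k j)
      ≈⟨ Σ-single j (λ k k≢j → trans (*-congˡ (I-offDiag k≢j)) (zeroʳ _)) ⟩
    A i j ✶ I R j j             ≈⟨ *-congˡ (I-diag j) ⟩
    A i j ✶ 1#                  ≈⟨ *-identityʳ _ ⟩
    A i j                       ∎

  ·-zeroˡ : ∀ {a b d} {A : Mat R a b} (B : Mat R b d) → _≋_ R A (O R) → _≋_ R (_·_ R A B) (O R)
  ·-zeroˡ B A≋O i j = Σ-zero (λ k → trans (*-congʳ (A≋O i k)) (zeroˡ _))

  ·-zeroʳ : ∀ {a b d} (A : Mat R a b) {B : Mat R b d} → _≋_ R B (O R) → _≋_ R (_·_ R A B) (O R)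
  ·-zeroʳ A B≋O i j = Σ-zero (λ k → trans (*-congˡ (B≋O k j)) (zeroʳ _))

  ⊛-·-⊛ : ∀ {a b d} x y (A : Mat R a b) (B : Mat R b d) →
          _≋_ R (_·_ R (_⊛_ R x A) (_⊛_ R y B)) (_⊛_ R (x ✶ y) (_·_ R A B))
  ⊛-·-⊛ x y A B i j =
    sym (trans (Σ-distribˡ (x ✶ y) (λ k → A i k ✶ B k j)) (Σ-cong (λ k → interchange x y (A i k) (B k j))))

  ⊛-cong : ∀ {a b} x {A B : Mat R a b} → _≋_ R A B → _≋_ R (_⊛_ R x A) (_⊛_ R x B)
  ⊛-cong x A≋B i j = *-congˡ (A≋B i j)

  ⊛-⊛ : ∀ {a b} x y (A : Mat R a b) → _≋_ R (_⊛_ R x (_⊛_ R y A)) (_⊛_ R (y ✶ x) A)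
  ⊛-⊛ x y A i j = trans (sym (*-assoc x y (A i j))) (*-congʳ (*-comm x y))

  ⊛-zero : ∀ {a b} x {A : Mat R a b} → _≋_ R A (O R) → _≋_ R (_⊛_ R x A) (O R)
  ⊛-zero x A≋O i j = trans (*-congˡ (A≋O i j)) (zeroʳ x)

  Π-cong : ∀ {n k} {A B : Fin k → Mat R n n} → (∀ a → _≋_ R (A a) (B a)) → _≋_ R (Π R A) (Π R B)
  Π-cong {k = zero}  A≋B = λ _ _ → refl
  Π-cong {k = suc k} A≋B = ·-cong (A≋B zero) (Π-cong (A≋B ∘ suc))

  Π-⊛ : ∀ {n k} (x : Fin k → Carrier) (A : Fin k → Mat R n n) →
        _≋_ R (Π R (λ a → _⊛_ R (x a) (A a))) (_⊛_ R (product x) (Π R A))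
  Π-⊛ {k = zero}  x A i j = sym (*-identityˡ _)
  Π-⊛ {k = suc k} x A i j = trans (·-congˡ (_⊛_ R (x zero) (A zero)) (Π-⊛ (x ∘ suc) (A ∘ suc)) i j)
                                  (⊛-·-⊛ (x zero) (product (x ∘ suc)) (A zero) (Π R (A ∘ suc)) i j)

  Π-zero : ∀ {n k} (A : Fin k → Mat R n n) (a : Fin k) → _≋_ R (A a) (O R) → _≋_ R (Π R A) (O R)
  Π-zero A zero    Aa≋O = ·-zeroˡ _ Aa≋O
  Π-zero A (suc a) Aa≋O = ·-zeroʳ (A zero) (Π-zero (A ∘ suc) a Aa≋O)

  -- combine α i is row l·α + i, the i-th row of block α (the paper's row l(α−1)+i)

  module _ {nb l : ℕ} where

    block : Mat R (nb * l) (nb * l) → Fin nb → Fin nb → Mat R l l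
    block A α β i j = A (combine α i) (combine β j)

    RowsInBlock : Mat R (nb * l) (nb * l) → Fin nb → Set ℓ
    RowsInBlock A α = ∀ β → β ≢ α → ∀ (j : Fin l) c → A (combine β j) c ≈ 0#

    ·-rowsInBlock : ∀ A B {α} → RowsInBlock A α → RowsInBlock (_·_ R A B) α
    ·-rowsInBlock A B A∈α β β≢α j c = Σ-zero (λ k → trans (*-congʳ (A∈α β β≢α j k)) (zeroˡ _))

    ⊛-rowsInBlock : ∀ x A {α} → RowsInBlock A α → RowsInBlock (_⊛_ R x A) α
    ⊛-rowsInBlock x A A∈α β β≢α j c = trans (*-congˡ (A∈α β β≢α j c)) (zeroʳ x)

    block-· : ∀ A B {γ} → RowsInBlock B γ → ∀ α β →
              _≋_ R (block (_·_ R A B) α β) (_·_ R (block A α γ) (block B γ β))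
    block-· A B {γ} B∈γ α β i j = begin
      Σ R (λ r → A (combine α i) r ✶ B r (combine β j))
        ≈⟨ Σ-combine nb l _ ⟩
      Σ R (λ (δ : Fin nb) → Σ R (λ (k : Fin l) →
        A (combine α i) (combine δ k) ✶ B (combine δ k) (combine β j)))
        ≈⟨ Σ-single γ (λ δ δ≢γ → Σ-zero (λ k → trans (*-congˡ (B∈γ δ δ≢γ k _)) (zeroʳ _))) ⟩
      Σ R (λ (k : Fin l) → A (combine α i) (combine γ k) ✶ B (combine γ k) (combine β j))
        ∎

    block-I : ∀ α → _≋_ R (block (I R) α α) (I R)
    block-I α i j with i ≟ j
    ... | yes ≡.refl = I-diag (combine α i)
    ... | no  i≢j    = I-offDiag (i≢j ∘ combine-injectiveʳ α i α j)

  minor : ∀ {n} → Mat R (suc n) (suc n) → Fin (suc n) → Mat R n n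
  minor A j r c = A (suc r) (punchIn j c)

  laplaceTerm : ∀ {n} → Mat R (suc n) (suc n) → Fin (suc n) → Carrier
  laplaceTerm A j = sgn R (toℕ j) ✶ (A zero j ✶ det R (minor A j))

  det-cong : ∀ {n} {A B : Mat R n n} → _≋_ R A B → det R A ≈ det R B
  det-cong {zero}  A≋B = refl
  det-cong {suc n} {A} {B} A≋B = Σ-cong {f = laplaceTerm A} {laplaceTerm B} (λ j →
    *-congˡ (*-cong (A≋B zero j) (det-cong (λ r c → A≋B (suc r) (punchIn j c)))))

  laplaceTerm-entry≈0 : ∀ {n} (A : Mat R (suc n) (suc n)) j → A zero j ≈ 0# → laplaceTerm A j ≈ 0#
  laplaceTerm-entry≈0 A j A₀ⱼ≈0 = trans (*-congˡ (trans (*-congʳ A₀ⱼ≈0) (zeroˡ _))) (zeroʳ _)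

  laplaceTerm-minor≈0 : ∀ {n} (A : Mat R (suc n) (suc n)) j → det R (minor A j) ≈ 0# → laplaceTerm A j ≈ 0#
  laplaceTerm-minor≈0 A j det≈0 = trans (*-congˡ (trans (*-congˡ det≈0) (zeroʳ _))) (zeroʳ _)

  det-zeroRow : ∀ {n} (A : Mat R n n) (r : Fin n) → (∀ c → A r c ≈ 0#) → det R A ≈ 0#
  det-zeroRow {suc n} A zero    A₀≈0 =
    Σ-zero {f = laplaceTerm A} (λ j → laplaceTerm-entry≈0 A j (A₀≈0 j))
  det-zeroRow {suc n} A (suc r) Ar≈0 =
    Σ-zero {f = laplaceTerm A} (λ j → laplaceTerm-minor≈0 A j (det-zeroRow (minor A j) r (Ar≈0 ∘ punchIn j)))

  UnitRow : ∀ {n} → Mat R n n → Fin n → Set ℓ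
  UnitRow A r = (A r r ≈ 1#) × (∀ c → r ≢ c → A r c ≈ 0#)

  unitRow-suc : ∀ {n} (A : Mat R (suc n) (suc n)) {r} → UnitRow A (suc r) → UnitRow (minor A zero) r
  unitRow-suc A (diag , off) = diag , λ c r≢c → off (suc c) (r≢c ∘ suc-injective)

  det-unitRow₀ : ∀ {n} (A : Mat R (suc n) (suc n)) → UnitRow A zero →
                 det R A ≈ det R (minor A zero)
  det-unitRow₀ A (diag , off) = begin
    Σ R (laplaceTerm A)
      ≈⟨ Σ-single {f = laplaceTerm A} zero (λ j j≢0 → laplaceTerm-entry≈0 A j (off j (j≢0 ∘ ≡.sym))) ⟩
    1# ✶ (A zero zero ✶ det R (minor A zero))
      ≈⟨ trans (*-identityˡ _) (trans (*-congʳ diag) (*-identityˡ _)) ⟩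
    det R (minor A zero) ∎

  det-unitRows : ∀ {n} (A : Mat R n n) → (∀ r → UnitRow A r) → det R A ≈ 1#
  det-unitRows {zero}  A unit = refl
  det-unitRows {suc n} A unit =
    trans (det-unitRow₀ A (unit zero)) (det-unitRows (minor A zero) (λ r → unitRow-suc A (unit (suc r))))

  det-unitRows-↑ˡ : ∀ a b (A : Mat R (a ℕ.+ b) (a ℕ.+ b)) → (∀ i → UnitRow A (i ↑ˡ b)) →
                    det R A ≈ det R (λ r c → A (a ↑ʳ r) (a ↑ʳ c))
  det-unitRows-↑ˡ zero    b A unit = refl
  det-unitRows-↑ˡ (suc a) b A unit =
    trans (det-unitRow₀ A (unit zero)) (det-unitRows-↑ˡ a b (minor A zero) (λ r → unitRow-suc A (unit (suc r))))

  det-unitRows-↑ʳ : ∀ a b (A : Mat R (a ℕ.+ b) (a ℕ.+ b)) → (∀ q → UnitRow A (a ↑ʳ q)) →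
                    det R A ≈ det R (λ i j → A (i ↑ˡ b) (j ↑ˡ b))
  det-unitRows-↑ʳ zero    b A unit = det-unitRows A unit
  det-unitRows-↑ʳ (suc a) b A unit = begin
    Σ R (laplaceTerm A)
      ≈⟨ Σ-splitAt (suc a) b (laplaceTerm A) ⟩
    Σ R (λ j → laplaceTerm A (j ↑ˡ b)) + Σ R (λ q → laplaceTerm A (suc a ↑ʳ q))
      ≈⟨ +-congˡ (Σ-zero {f = λ q → laplaceTerm A (suc a ↑ʳ q)} (λ q →
           laplaceTerm-minor≈0 A _ (det-zeroRow _ (a ↑ʳ q) (minor-zeroRow q)))) ⟩
    Σ R (λ j → laplaceTerm A (j ↑ˡ b)) + 0#
      ≈⟨ +-identityʳ _ ⟩
    Σ R (λ j → laplaceTerm A (j ↑ˡ b))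
      ≈⟨ Σ-cong {f = λ j → laplaceTerm A (j ↑ˡ b)} {laplaceTerm (λ i j → A (i ↑ˡ b) (j ↑ˡ b))} (λ j →
           *-cong (reflexive (≡.cong (sgn R) (toℕ-↑ˡ j b))) (*-congˡ (minor-↑ˡ j))) ⟩
    Σ R (laplaceTerm (λ i j → A (i ↑ˡ b) (j ↑ˡ b))) ∎
    where
      -- deleting the column of a unit row leaves that row zero
      minor-zeroRow : ∀ q c → minor A (suc a ↑ʳ q) (a ↑ʳ q) c ≈ 0#
      minor-zeroRow q c = proj₂ (unit q) _ (punchInᵢ≢i _ c ∘ ≡.sym)

      minor-unitRows : ∀ j q → UnitRow (minor A (j ↑ˡ b)) (a ↑ʳ q)
      minor-unitRows j q =
        trans (reflexive (≡.cong (A (suc a ↑ʳ q)) (punchIn-↑ˡ-↑ʳ a b j q))) (proj₁ (unit q)) ,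
        λ c q≢c → proj₂ (unit q) _
                    (q≢c ∘ punchIn-injective (j ↑ˡ b) _ _ ∘ ≡.trans (punchIn-↑ˡ-↑ʳ a b j q))

      minor-↑ˡ : ∀ j → det R (minor A (j ↑ˡ b)) ≈ det R (minor (λ i j → A (i ↑ˡ b) (j ↑ˡ b)) j)
      minor-↑ˡ j = trans (det-unitRows-↑ʳ a b _ (minor-unitRows j))
                         (det-cong (λ r c → reflexive (≡.cong (A (suc r ↑ˡ b)) (punchIn-↑ˡ b j c))))

  det-unitRows-outsideBlock : ∀ nb l (A : Mat R (nb * l) (nb * l)) (α : Fin nb) →
    (∀ β (j : Fin l) → β ≢ α → UnitRow A (combine β j)) → det R A ≈ det R (block {nb} {l} A α α)
  det-unitRows-outsideBlock (suc nb) l A zero unit = det-unitRows-↑ʳ l (nb * l) A unit′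
    where
      unit′ : ∀ q → UnitRow A (l ↑ʳ q)
      unit′ q = ≡.subst (λ q → UnitRow A (l ↑ʳ q)) (combine-remQuot {nb} l q)
                        (unit (suc (proj₁ (remQuot {nb} l q))) (proj₂ (remQuot {nb} l q)) λ ())
  det-unitRows-outsideBlock (suc nb) l A (suc α) unit =
    trans (det-unitRows-↑ˡ l (nb * l) A (λ i → unit zero i λ ()))
          (det-unitRows-outsideBlock nb l _ α λ β j β≢α →
            let diag , off = unit (suc β) j (β≢α ∘ suc-injective)
            in diag , λ c j≢c → off (l ↑ʳ c) (j≢c ∘ ↑ʳ-injective l _ _))

  det-I⊖-cong : ∀ {n} {P Q : Mat R n n} → _≋_ R P Q → det R (_⊖_ R (I R) P) ≈ det R (_⊖_ R (I R) Q)
  det-I⊖-cong P≋Q = det-cong (λ i j → +-congˡ (-‿cong (P≋Q i j)))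

  unitRow-I⊖ : ∀ {n} (P : Mat R n n) r → (∀ c → P r c ≈ 0#) → UnitRow (_⊖_ R (I R) P) r
  unitRow-I⊖ P r Pᵣ≈0 =
    trans (x-y≈x (Pᵣ≈0 r)) (I-diag r) , λ c r≢c → trans (x-y≈x (Pᵣ≈0 c)) (I-offDiag r≢c)

  det-I⊖O : ∀ {n} → det R (_⊖_ R (I R) (O R {n} {n})) ≈ 1#
  det-I⊖O {n} = det-unitRows (_⊖_ R (I R) (O R {n} {n})) (λ r → unitRow-I⊖ (O R) r (λ _ → refl))

  det-I⊖-rowsInBlock : ∀ {nb l} (P : Mat R (nb * l) (nb * l)) (α : Fin nb) → RowsInBlock P α →
    det R (_⊖_ R (I R) P) ≈ det R (_⊖_ R (I R) (block {nb} {l} P α α))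
  det-I⊖-rowsInBlock {nb} {l} P α P∈α =
    trans (det-unitRows-outsideBlock nb l (_⊖_ R (I R) P) α (λ β j β≢α → unitRow-I⊖ P _ (P∈α β β≢α j)))
          (det-cong {l} (λ i j → +-congʳ (block-I {nb} {l} α i j)))

module SequenceProperties {c ℓ : Level} (R : CommutativeRing c ℓ) where
  open CommutativeRing R renaming (_*_ to _✶_) hiding (zero)
  open MatrixProperties R using (product)

  next-inject₁ : ∀ {k} (i : Fin k) → next R (inject₁ i) ≡ suc i
  next-inject₁ {k} i with suc (toℕ (inject₁ i)) <? suc k
  ... | yes p = toℕ-injective (≡.trans (toℕ-fromℕ< p) (≡.cong suc (toℕ-inject₁ i)))
  ... | no ¬p = contradiction (ℕ.s<s (inject₁ℕ< i)) ¬p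

  next-fromℕ : ∀ k → next R (fromℕ k) ≡ zero
  next-fromℕ k with suc (toℕ (fromℕ k)) <? suc k
  ... | yes p = contradiction (≡.subst (λ x → suc x ℕ.< suc k) (toℕ-fromℕ k) p) (ℕ.<-irrefl ≡.refl)
  ... | no  _ = ≡.refl

  pow-count : ∀ {k} x (P : Fin k → Set) (d : ∀ i → Dec (P i)) →
              pow R x (count R P d) ≈ product (λ i → if ⌊ d i ⌋ then x else 1#)
  pow-count {zero}  x P d = refl
  pow-count {suc k} x P d with d zero
  ... | yes _ = *-congˡ (pow-count x (P ∘ suc) (d ∘ suc))
  ... | no  _ = trans (pow-count x (P ∘ suc) (d ∘ suc)) (sym (*-identityˡ _))

module VoltageMatrices {c ℓ : Level} (R : CommutativeRing c ℓ) {H : Hypergraph} {m n l : ℕ}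
                       (en : Fin (2 * m) ↔ Arc H) (Φ : PermVoltage H n)
                       (ρ : Permutation′ n → Mat R l l) (u : CommutativeRing.Carrier R) where
  open CommutativeRing R renaming (_*_ to _✶_) hiding (zero)
  open MatrixProperties R
  open SequenceProperties R
  open Setup R {H} {m} {n} {l} en Φ ρ u
  open SetoidReasoning setoid

  B+uJ : Mat R (2 * m * l) (2 * m * l)
  B+uJ = _⊕_ R Bm (_⊛_ R u Jm)

  block-flatten : ∀ F α β i j → block (flatten F) α β i j ≡ F α β i j
  block-flatten F α β i j rewrite quotRem-combine l α i | quotRem-combine l β j = ≡.refl

  block-B+uJ : ∀ α β → _≋_ R (block B+uJ α β) (_⊕_ R (bBlock α β) (_⊛_ R u (jBlock α β)))
  block-B+uJ α β i j =
    reflexive (≡.cong₂ (λ x y → x + u ✶ y) (block-flatten bBlock α β i j) (block-flatten jBlock α β i j))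

  rowsInBlock-M : ∀ α → RowsInBlock (M α) α
  rowsInBlock-M α β β≢α j c with proj₂ (quotRem l (combine β j)) ≟ α
  ... | yes β≡α = contradiction (≡.trans (≡.sym (≡.cong proj₂ (quotRem-combine l β j))) β≡α) β≢α
  ... | no  _   = refl

  block-M : ∀ α β → _≋_ R (block (M α) α β) (block B+uJ α β)
  block-M α β i j with proj₂ (quotRem l (combine α i)) ≟ α
  ... | yes _   = refl
  ... | no  α≢α = contradiction (≡.cong proj₂ (quotRem-combine l α i)) α≢α

  rowsInBlock-Π-M : ∀ {k} (s : Fin (suc k) → Fin (2 * m)) → RowsInBlock (Π R (M ∘ s)) (s zero)
  rowsInBlock-Π-M s = ·-rowsInBlock (M (s zero)) (Π R (M ∘ s ∘ suc)) (rowsInBlock-M (s zero))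

  -- σ a is the block following s a: the walk s 0, s 1, …, s k, σ k
  block-Π-M : ∀ {k} (s σ : Fin (suc k) → Fin (2 * m)) → (∀ a → σ (inject₁ a) ≡ s (suc a)) →
              _≋_ R (block (Π R (M ∘ s)) (s zero) (σ (fromℕ k))) (Π R (λ a → block B+uJ (s a) (σ a)))
  block-Π-M {zero} s σ _ i j = begin
    block (_·_ R (M (s zero)) (I R)) (s zero) (σ zero) i j ≈⟨ ·-identityʳ (M (s zero)) _ _ ⟩
    block (M (s zero)) (s zero) (σ zero) i j              ≈⟨ block-M (s zero) (σ zero) i j ⟩
    block B+uJ (s zero) (σ zero) i j                      ≈⟨ ·-identityʳ (block B+uJ (s zero) (σ zero)) i j ⟨
    _·_ R (block B+uJ (s zero) (σ zero)) (I R) i j        ∎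
  block-Π-M {suc k} s σ σ≡s⁺ i j rewrite σ≡s⁺ zero = begin
    block (_·_ R (M s₀) rest) s₀ last i j
      ≈⟨ block-· (M s₀) rest (rowsInBlock-Π-M (s ∘ suc)) s₀ last i j ⟩
    _·_ R (block (M s₀) s₀ s₁) (block rest s₁ last) i j
      ≈⟨ ·-cong (block-M s₀ s₁) (block-Π-M (s ∘ suc) (σ ∘ suc) (σ≡s⁺ ∘ suc)) i j ⟩
    _·_ R (block B+uJ s₀ s₁) (Π R (λ a → block B+uJ (s (suc a)) (σ (suc a)))) i j ∎
    where
      s₀ = s zero
      s₁ = s (suc zero)
      rest = Π R (M ∘ s ∘ suc)
      last = σ (fromℕ (suc k))

  closedWalk : ∀ {k} → (Fin (suc k) → Fin (2 * m)) → Mat R l l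
  closedWalk s = Π R (λ a → block B+uJ (s a) (s (next R a)))

  block-Π-M-closed : ∀ {k} (s : Fin (suc k) → Fin (2 * m)) →
                     _≋_ R (block (Π R (M ∘ s)) (s zero) (s zero)) (closedWalk s)
  block-Π-M-closed {k} s = ≡.subst (λ β → _≋_ R (block (Π R (M ∘ s)) (s zero) β) (closedWalk s))
                                   (≡.cong s (next-fromℕ k))
                                   (block-Π-M s (s ∘ next R) (≡.cong s ∘ next-inject₁))

  e-injective : ∀ {α β} → e α ≡ e β → α ≡ β
  e-injective = Injection.injective (↔⇒↣ en)

  ≡invIdx⇒reverse : ∀ {α β} → α ≡ invIdx β → e β ≡ e α ⁻¹
  ≡invIdx⇒reverse {β = β} α≡β⁻¹ =
    ⁻¹-swap (≡.trans (≡.cong e α≡β⁻¹) (Inverse.strictlyInverseˡ en (e β ⁻¹)))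

  reverse⇒≡invIdx : ∀ {α β} → e β ≡ e α ⁻¹ → α ≡ invIdx β
  reverse⇒≡invIdx {β = β} β≡α⁻¹ =
    e-injective (≡.trans (⁻¹-swap β≡α⁻¹) (≡.sym (Inverse.strictlyInverseˡ en (e β ⁻¹))))

  block-B+uJ-linked : ∀ α β → t (e α) ≡ o (e β) → (d : Dec (e β ≡ e α ⁻¹)) →
                      _≋_ R (block B+uJ α β) (_⊛_ R (if ⌊ d ⌋ then u else 1#) (ρφ α))
  block-B+uJ-linked α β linked d i j = trans (block-B+uJ α β i j) (entry d)
    where
      entry : (d : Dec (e β ≡ e α ⁻¹)) →
              bBlock α β i j + u ✶ jBlock α β i j ≈ (if ⌊ d ⌋ then u else 1#) ✶ ρφ α i j
      entry d with _≟V_ {H} (t (e α)) (o (e β)) | α ≟ invIdx β | d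
      ... | no unlinked | _        | _        = contradiction linked unlinked
      ... | yes _       | yes _    | yes _    = +-identityˡ _
      ... | yes _       | yes α≡β⁻¹ | no ¬rev = contradiction (≡invIdx⇒reverse α≡β⁻¹) ¬rev
      ... | yes _       | no α≢β⁻¹ | yes rev  = contradiction (reverse⇒≡invIdx rev) α≢β⁻¹
      ... | yes _       | no _     | no _     =
        trans (+-congˡ (zeroʳ u)) (trans (+-identityʳ _) (sym (*-identityˡ _)))

  block-B+uJ-unlinked : ∀ α β → t (e α) ≢ o (e β) → _≋_ R (block B+uJ α β) (O R)
  block-B+uJ-unlinked α β unlinked i j = trans (block-B+uJ α β i j) entry
    where
      entry : bBlock α β i j + u ✶ jBlock α β i j ≈ 0#
      entry with _≟V_ {H} (t (e α)) (o (e β)) | α ≟ invIdx β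
      ... | yes linked | _        = contradiction linked unlinked
      ... | no _       | yes α≡β⁻¹ =
        contradiction (≡.trans (≡.cong t (⁻¹-swap (≡invIdx⇒reverse α≡β⁻¹))) (t-⁻¹ (e β))) unlinked
      ... | no _       | no _     = trans (+-identityˡ _) (zeroʳ u)

  module ClosedWalk {k : ℕ} (s : Fin (suc k) → Fin (2 * m)) where
    open Seq R {H} {m} en s

    -- copies the decision procedure in the definition of cbc, so that cbc unfolds to count R _ reversal?
    reversal? : ∀ a → Dec (f (next R a) ≡ f a ⁻¹)
    reversal? a = map′ (λ q → ≡.trans (≡.cong (Inverse.to en) q) (Inverse.strictlyInverseˡ en (f a ⁻¹)))
                       (λ q → ≡.trans (≡.sym (Inverse.strictlyInverseʳ en (s (next R a))))
                                      (≡.cong (Inverse.from en) q))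
                       (s (next R a) ≟ Inverse.from en (f a ⁻¹))

    closedWalk-isCycle : IsCycle → _≋_ R (closedWalk s) (_⊛_ R (pow R u cbc) (Π R (ρφ ∘ s)))
    closedWalk-isCycle cycle i j = begin
      closedWalk s i j
        ≈⟨ Π-cong (λ a → block-B+uJ-linked (s a) (s (next R a)) (cycle a) (reversal? a)) i j ⟩
      Π R (λ a → _⊛_ R (if ⌊ reversal? a ⌋ then u else 1#) (ρφ (s a))) i j
        ≈⟨ Π-⊛ (λ a → if ⌊ reversal? a ⌋ then u else 1#) (ρφ ∘ s) i j ⟩
      product (λ a → if ⌊ reversal? a ⌋ then u else 1#) ✶ Π R (ρφ ∘ s) i j
        ≈⟨ *-congʳ (sym (pow-count u _ reversal?)) ⟩
      pow R u cbc ✶ Π R (ρφ ∘ s) i j ∎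

    closedWalk-¬isCycle : ¬ IsCycle → _≋_ R (closedWalk s) (O R)
    closedWalk-¬isCycle ¬cycle
      with a , unlinked ← ¬∀⟶∃¬ (suc k) _ (λ a → _≟V_ {H} (t (f a)) (o (f (next R a)))) ¬cycle
      = Π-zero (λ a → block B+uJ (s a) (s (next R a))) a (block-B+uJ-unlinked _ _ unlinked)

lemma4p7 : ∀ {c ℓ : Level} (R : CommutativeRing c ℓ) (H : Hypergraph) →
  NonemptyEdges H → Covering H → WithoutLoops H → Connected H → DegreeAtLeastTwo H →
  (m : ℕ) (en : Fin (2 * m) ↔ Arc H) →
  (n : ℕ) (Φ : PermVoltage H n) →
  (l : ℕ) (ρ : Permutation′ n → Mat R l l) → IsRepresentation R Φ ρ →
  (u t : CommutativeRing.Carrier R) →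
  (k : ℕ) (s : Fin (suc k) → Fin (2 * m)) →
  let open Setup R {H} {m} {n} {l} en Φ ρ u
      open Seq R {H} {m} en {k} s
      lhs = det R (_⊖_ R (I R) (_⊛_ R (pow R t (suc k)) (Π R (λ i → M (s i)))))
  in (IsCycle → CommutativeRing._≈_ R lhs
                  (det R (_⊖_ R (I R) (_⊛_ R (CommutativeRing._*_ R (pow R u cbc) (pow R t (suc k)))
                                            (Π R (λ i → ρφ (s i)))))))
   × (¬ IsCycle → CommutativeRing._≈_ R lhs (CommutativeRing.1# R))
lemma4p7 R H _ _ _ _ _ m en n Φ l ρ _ u t′ k s =
  (λ cycle → trans reduce (det-I⊖-cong (λ i j →
     trans (⊛-cong τ (closedWalk-isCycle cycle) i j) (⊛-⊛ τ (pow R u cbc) (Π R (ρφ ∘ s)) i j)))) ,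
  (λ ¬cycle → trans reduce (trans (det-I⊖-cong (⊛-zero τ (closedWalk-¬isCycle ¬cycle))) (det-I⊖O {l})))
  where
    open CommutativeRing R renaming (_*_ to _✶_) hiding (zero)
    open MatrixProperties R
    open VoltageMatrices R {H} {m} {n} {l} en Φ ρ u
    open Setup R {H} {m} {n} {l} en Φ ρ u using (M; ρφ)
    open Seq R {H} {m} en s using (cbc)
    open ClosedWalk s

    τ = pow R t′ (suc k)

    reduce : det R (_⊖_ R (I R) (_⊛_ R τ (Π R (M ∘ s)))) ≈ det R (_⊖_ R (I R) (_⊛_ R τ (closedWalk s)))
    reduce = trans (det-I⊖-rowsInBlock _ (s zero) (⊛-rowsInBlock τ (Π R (M ∘ s)) (rowsInBlock-Π-M s)))
                   (det-I⊖-cong (⊛-cong τ (block-Π-M-closed s)))
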